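{- Let $k\geq1$ and $n\geq1$. The number of $k$-box paths of size $n$ equals the number of $(k+1)$-tuples of $(k+2)$-ary trees with a total of $n-1$ nodes, which is \[f_{k,n}=\frac{1}{(k+2)n-1}\binom{(k+2)n-1}{n};\] moreover, for $n\geq2$ this also equals $\frac{k+1}{n-1}\binom{(k+2)n-2}{n-2}$.
   Context: A skew Dyck path is a word $w$ over $\{U,D,L\}$ such that: $w$ contains neither $UL$ nor $LU$ as a contiguous subword; the number of $U$s equals the total number of $D$s and $L$s; and in every prefix the total number of $D$s and $L$s is at most the number of $U$s. Its semilength is its number of $U$s. A factor is a contiguous subword; $X^{m}$ denotes $m$ consecutive copies of $X$. For $k\geq1$, a $k$-box path of size $n$ is a skew Dyck path of semilength $(k+2)n-1$ containing exactly $n$ occurrences of the factor $UD^{k}L$. An $m$-ary tree is a rooted tree (possibly empty) in which each node has at most $m$ children, each child being assigned a distinct position among $m$ ordered positions (first, second, ..., $m$-th child). -}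

module Defs where

open import Data.Nat using (ℕ; zero; suc; _+_; _*_; _∸_; _≤ᵇ_; _≡ᵇ_)
open import Data.Bool using (Bool; true; false; _∧_; not; T)
open import Data.List using (List; []; _∷_; inits; tails; length; filter; replicate; _++_)
open import Data.List.Relation.Unary.All using (All)
open import Data.Vec using (Vec; []; _∷_)
open import Data.Product using (Σ; _×_)
open import Relation.Binary.PropositionalEquality using (_≡_)

data Step : Set where
  U D L : Step

_=ˢ_ : Step → Step → Bool
U =ˢ U = true
D =ˢ D = true
L =ˢ L = true
_ =ˢ _ = false

isU : Step → Bool
isU U = true
isU _ = false

isDL : Step → Bool
isDL U = false
isDL _ = true

b2n : Bool → ℕ
b2n true = 1
b2n false = 0

countU : List Step → ℕ
countU [] = 0
countU (s ∷ w) = b2n (isU s) + countU w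

countDL : List Step → ℕ
countDL [] = 0
countDL (s ∷ w) = b2n (isDL s) + countDL w

noULLU : List Step → Bool
noULLU (U ∷ L ∷ _) = false
noULLU (L ∷ U ∷ _) = false
noULLU (_ ∷ w) = noULLU w
noULLU [] = true

allB : {A : Set} → (A → Bool) → List A → Bool
allB p [] = true
allB p (x ∷ xs) = p x ∧ allB p xs

prefixOK : List Step → Bool
prefixOK w = allB (λ p → countDL p ≤ᵇ countU p) (inits w)

isSkewDyck : List Step → Bool
isSkewDyck w = noULLU w ∧ (countU w ≡ᵇ countDL w) ∧ prefixOK w

isPrefixOf : List Step → List Step → Bool
isPrefixOf [] _ = true
isPrefixOf (x ∷ xs) [] = false
isPrefixOf (x ∷ xs) (y ∷ ys) = (x =ˢ y) ∧ isPrefixOf xs ys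

occurrences : List Step → List Step → ℕ
occurrences p w = countB (tails w)
  where
  countB : List (List Step) → ℕ
  countB [] = 0
  countB (t ∷ ts) with isPrefixOf p t
  ... | true = suc (countB ts)
  ... | false = countB ts

box : ℕ → List Step
box k = U ∷ (replicate k D ++ (L ∷ []))

isKBoxPath : ℕ → ℕ → List Step → Bool
isKBoxPath k n w =
  isSkewDyck w ∧ (countU w ≡ᵇ ((k + 2) * n ∸ 1)) ∧ (occurrences (box k) w ≡ᵇ n)

KBoxPath : ℕ → ℕ → Set
KBoxPath k n = Σ (List Step) (λ w → T (isKBoxPath k n w))

data Tree (m : ℕ) : Set where
  empty : Tree m
  node  : Vec (Tree m) m → Tree m

mutual
  size : {m : ℕ} → Tree m → ℕ
  size empty = 0
  size (node ts) = suc (sizes ts)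

  sizes : {m j : ℕ} → Vec (Tree m) j → ℕ
  sizes [] = 0
  sizes (t ∷ ts) = size t + sizes ts

TreeTuple : ℕ → ℕ → Set
TreeTuple k n = Σ (Vec (Tree (k + 2)) (k + 1)) (λ ts → sizes ts ≡ n ∸ 1)

-- In a k-box path every box U D^k L but the last is followed by a D, so the path reads uniquely
-- as a word over {u, x}, with u standing for U and x for U D^k L D, closed by a final box.
-- Reversed, that word is the Łukasiewicz code of a (k+1)-tuple of (k+2)-ary trees (x a node,
-- u an empty subtree) with its last letter dropped, and the path stays non-negative exactly
-- when the code's counter stays positive. Paths and tree tuples thus obey the same recursion
-- "the first tree is empty, or a node whose k+2 subtrees join the remaining trees", solved by
-- forests. Along that recursion Pascal's rule proves the ballot form
-- forests + (m-1) C(N, s) = C(N, s+1) of the count, and absorption turns it into the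
-- binomial formulas.
module Submission where

open import Defs
open import Data.Bool using (Bool; true; false; _∧_; T; T?)
open import Data.Bool.Properties using (∧-identityʳ; T-≡; T-∧; T-irrelevant)
open import Data.Empty using (⊥-elim)
open import Data.Fin using (Fin)
import Data.Fin as Fin
open import Data.Fin.Properties using (+↔⊎)
open import Data.List using (List; []; _∷_; _++_; [_]; length; map; inits; replicate; reverse)
open import Data.List.Properties
  using (++-identityʳ; ++-cancelˡ; ∷-injectiveʳ; unfold-reverse; reverse-involutive; length-reverse; length-++)
open import Data.Nat
open import Data.Nat.Properties
open import Data.Nat.Combinatorics using (_C_; nC1≡n; nCk+nC[k+1]≡[n+1]C[k+1])
open import Data.Nat.Tactic.RingSolver using (solve-∀)
open import Data.Product using (Σ; ∃; _×_; _,_; proj₁; proj₂)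
open import Data.Product.Properties using (Σ-≡,≡→≡)
open import Data.Sum using (_⊎_; inj₁; inj₂)
open import Data.Sum.Function.Propositional using (_⊎-↔_)
open import Data.Vec as Vec using (Vec; []; _∷_; take; drop)
open import Data.Vec.Properties using (take++drop≡id; ++-injective)
open import Function using (_∘_; _⇔_; Equivalence; mk⇔)
open import Function.Bundles using (_↔_; mk↔ₛ′)
open import Function.Properties.Inverse using (↔-trans; ↔-sym)
open import Relation.Binary.PropositionalEquality hiding ([_])
open import Relation.Nullary using (¬_; yes; no; Irrelevant)

open ≡-Reasoning

-- forests m s j counts j-tuples of m-ary trees with s nodes in all.
forests : ℕ → ℕ → ℕ → ℕ
forests m zero    zero    = 1
forests m (suc s) zero    = 0
forests m zero    (suc j) = forests m zero j
forests m (suc s) (suc j) = forests m (suc s) j + forests m s (m + j)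

forests-nodeless : ∀ m j → forests m 0 j ≡ 1
forests-nodeless m zero    = refl
forests-nodeless m (suc j) = forests-nodeless m j

forests-oneNode : ∀ m j → forests m 1 j ≡ j
forests-oneNode m zero    = refl
forests-oneNode m (suc j) = begin
  forests m 1 j + forests m 0 (m + j) ≡⟨ cong₂ _+_ (forests-oneNode m j) (forests-nodeless m (m + j)) ⟩
  j + 1                               ≡⟨ +-comm j 1 ⟩
  suc j                               ∎

[k+1]*[n+1]C[k+1]≡[n+1]*nCk : ∀ n k → suc k * (suc n C suc k) ≡ suc n * (n C k)
[k+1]*[n+1]C[k+1]≡[n+1]*nCk zero    zero    = refl
[k+1]*[n+1]C[k+1]≡[n+1]*nCk zero    (suc k) = *-zeroʳ (suc (suc k))
[k+1]*[n+1]C[k+1]≡[n+1]*nCk (suc n) zero    = begin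
  1 * (suc (suc n) C 1) ≡⟨ *-identityˡ _ ⟩
  suc (suc n) C 1       ≡⟨ nC1≡n (suc (suc n)) ⟩
  suc (suc n)           ≡⟨ *-identityʳ (suc (suc n)) ⟨
  suc (suc n) * 1       ∎
[k+1]*[n+1]C[k+1]≡[n+1]*nCk (suc n) (suc k) = begin
  suc (suc k) * (suc (suc n) C suc (suc k))  ≡⟨ cong (suc (suc k) *_) (nCk+nC[k+1]≡[n+1]C[k+1] (suc n) (suc k)) ⟨
  suc (suc k) * (a + b)                      ≡⟨ *-distribˡ-+ (suc (suc k)) a b ⟩
  a + suc k * a + suc (suc k) * b            ≡⟨ cong₂ (λ p q → a + p + q) ([k+1]*[n+1]C[k+1]≡[n+1]*nCk n k)
                                                                         ([k+1]*[n+1]C[k+1]≡[n+1]*nCk n (suc k)) ⟩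
  a + suc n * (n C k) + suc n * (n C suc k)  ≡⟨ +-assoc a _ _ ⟩
  a + (suc n * (n C k) + suc n * (n C suc k)) ≡⟨ cong (a +_) (*-distribˡ-+ (suc n) (n C k) (n C suc k)) ⟨
  a + suc n * (n C k + n C suc k)            ≡⟨ cong (λ p → a + suc n * p) (nCk+nC[k+1]≡[n+1]C[k+1] n k) ⟩
  suc (suc n) * a                            ∎
  where a = suc n C suc k
        b = suc n C suc (suc k)

d+k≡n⇒[k+1]*nC[k+1]≡d*nCk : ∀ {n} d k → d + k ≡ n → suc k * (n C suc k) ≡ d * (n C k)
d+k≡n⇒[k+1]*nC[k+1]≡d*nCk d k refl = +-cancelˡ-≡ (suc k * a) _ _ (begin
  suc k * a + suc k * b         ≡⟨ *-distribˡ-+ (suc k) a b ⟨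
  suc k * (a + b)               ≡⟨ cong (suc k *_) (nCk+nC[k+1]≡[n+1]C[k+1] (d + k) k) ⟩
  suc k * (suc (d + k) C suc k) ≡⟨ [k+1]*[n+1]C[k+1]≡[n+1]*nCk (d + k) k ⟩
  suc (d + k) * a               ≡⟨ split d k a ⟩
  suc k * a + d * a             ∎)
  where
  a = (d + k) C k
  b = (d + k) C suc k
  split : ∀ d k a → suc (d + k) * a ≡ suc k * a + d * a
  split = solve-∀

module _ (c : ℕ) where

  forests-ballot : ∀ s j → forests (suc c) (suc s) j + c * ((suc c * s + c + j) C s) ≡ (suc c * s + c + j) C suc s
  forests-ballot zero j = begin
    forests (suc c) 1 j + c * 1 ≡⟨ cong (_+ c * 1) (forests-oneNode (suc c) j) ⟩
    j + c * 1                   ≡⟨ e c j ⟩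
    suc c * 0 + c + j           ≡⟨ nC1≡n _ ⟨
    (suc c * 0 + c + j) C 1     ∎
    where e : ∀ c j → j + c * 1 ≡ suc c * 0 + c + j
          e = solve-∀
  forests-ballot (suc s) zero =
    subst (λ n → c * (n C suc s) ≡ n C suc (suc s)) (shift c s) (*-cancelˡ-≡ _ _ (suc (suc s)) (begin
    suc (suc s) * (c * (N C suc s)) ≡⟨ e c s (N C suc s) ⟩
    c * suc (suc s) * (N C suc s)   ≡⟨ d+k≡n⇒[k+1]*nC[k+1]≡d*nCk (c * suc (suc s)) (suc s) refl ⟨
    suc (suc s) * (N C suc (suc s)) ∎))
    where
    N = c * suc (suc s) + suc s
    shift : ∀ c s → c * suc (suc s) + suc s ≡ suc c * suc s + c + 0
    shift = solve-∀
    e : ∀ c s x → suc (suc s) * (c * x) ≡ c * suc (suc s) * x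
    e = solve-∀
  forests-ballot (suc s) (suc j) = begin
    A + B + c * ((suc c * suc s + c + suc j) C suc s)
      ≡⟨ cong (λ n → A + B + c * (n C suc s)) (+-suc (suc c * suc s + c) j) ⟩
    A + B + c * (suc N C suc s)
      ≡⟨ cong (λ t → A + B + c * t) (nCk+nC[k+1]≡[n+1]C[k+1] N s) ⟨
    A + B + c * (N C s + N C suc s)
      ≡⟨ regroup A B c (N C s) (N C suc s) ⟩
    (B + c * (N C s)) + (A + c * (N C suc s))
      ≡⟨ cong₂ _+_ ih₂ (forests-ballot (suc s) j) ⟩
    N C suc s + N C suc (suc s)
      ≡⟨ nCk+nC[k+1]≡[n+1]C[k+1] N (suc s) ⟩
    suc N C suc (suc s)
      ≡⟨ cong (_C suc (suc s)) (+-suc (suc c * suc s + c) j) ⟨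
    (suc c * suc s + c + suc j) C suc (suc s) ∎
    where
    A = forests (suc c) (suc (suc s)) j
    B = forests (suc c) (suc s) (suc c + j)
    N = suc c * suc s + c + j
    regroup : ∀ a b c x y → a + b + c * (x + y) ≡ (b + c * x) + (a + c * y)
    regroup = solve-∀
    reindex : ∀ c s j → suc c * s + c + (suc c + j) ≡ suc c * suc s + c + j
    reindex = solve-∀
    ih₂ : B + c * (N C s) ≡ N C suc s
    ih₂ = subst (λ n → B + c * (n C s) ≡ n C suc s) (reindex c s j) (forests-ballot s (suc c + j))

  forests-closedForm : ∀ s j → suc s * forests (suc c) (suc s) j ≡ j * ((suc c * s + c + j) C s)
  forests-closedForm s j = +-cancelʳ-≡ (suc s * (c * a)) _ _ (begin
    suc s * F + suc s * (c * a)  ≡⟨ *-distribˡ-+ (suc s) F (c * a) ⟨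
    suc s * (F + c * a)          ≡⟨ cong (suc s *_) (forests-ballot s j) ⟩
    suc s * (N C suc s)          ≡⟨ d+k≡n⇒[k+1]*nC[k+1]≡d*nCk (c * suc s + j) s (e₁ c s j) ⟩
    (c * suc s + j) * a          ≡⟨ e₂ c s j a ⟩
    j * a + suc s * (c * a)      ∎)
    where
    F = forests (suc c) (suc s) j
    N = suc c * s + c + j
    a = N C s
    e₁ : ∀ c s j → c * suc s + j + s ≡ suc c * s + c + j
    e₁ = solve-∀
    e₂ : ∀ c s j a → (c * suc s + j) * a ≡ j * a + suc s * (c * a)
    e₂ = solve-∀

  forests-formula : ∀ s j → forests (suc c) s j * (suc c * s + j) ≡ j * ((suc c * s + j) C s)
  forests-formula zero j = begin
    forests (suc c) 0 j * (suc c * 0 + j) ≡⟨ cong (_* (suc c * 0 + j)) (forests-nodeless (suc c) j) ⟩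
    1 * (suc c * 0 + j)                   ≡⟨ e c j ⟩
    j * 1                                 ∎
    where e : ∀ c j → 1 * (suc c * 0 + j) ≡ j * 1
          e = solve-∀
  forests-formula (suc s) j = *-cancelˡ-≡ _ _ (suc s) (begin
    suc s * (F * M)                  ≡⟨ *-assoc (suc s) F M ⟨
    suc s * F * M                    ≡⟨ cong (_* M) (forests-closedForm s j) ⟩
    j * (N C s) * M                  ≡⟨ cong (j * (N C s) *_) M≡1+N ⟩
    j * (N C s) * suc N              ≡⟨ e₂ j (N C s) (suc N) ⟩
    j * (suc N * (N C s))            ≡⟨ cong (j *_) ([k+1]*[n+1]C[k+1]≡[n+1]*nCk N s) ⟨
    j * (suc s * (suc N C suc s))    ≡⟨ cong (λ n → j * (suc s * (n C suc s))) M≡1+N ⟨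
    j * (suc s * (M C suc s))        ≡⟨ e₃ j (suc s) (M C suc s) ⟩
    suc s * (j * (M C suc s))        ∎)
    where
    F = forests (suc c) (suc s) j
    M = suc c * suc s + j
    N = suc c * s + c + j
    e₁ : ∀ c s j → suc c * suc s + j ≡ suc (suc c * s + c + j)
    e₁ = solve-∀
    M≡1+N : M ≡ suc N
    M≡1+N = e₁ c s j
    e₂ : ∀ x y z → x * y * z ≡ x * (z * y)
    e₂ = solve-∀
    e₃ : ∀ x y z → x * (y * z) ≡ y * (x * z)
    e₃ = solve-∀

  forests-binomial : ∀ n → forests (suc c) n c * (suc c * n + c) ≡ (suc c * n + c) C suc n
  forests-binomial n = begin
    forests (suc c) n c * M ≡⟨ forests-formula n c ⟩
    c * (M C n)             ≡⟨ *-cancelˡ-≡ _ _ (suc n) (begin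
      suc n * (c * (M C n))     ≡⟨ e c n (M C n) ⟩
      c * suc n * (M C n)       ≡⟨ d+k≡n⇒[k+1]*nC[k+1]≡d*nCk (c * suc n) n (e′ c n) ⟨
      suc n * (M C suc n)       ∎) ⟩
    M C suc n               ∎
    where
    M = suc c * n + c
    e : ∀ c n x → suc n * (c * x) ≡ c * suc n * x
    e = solve-∀
    e′ : ∀ c n → c * suc n + n ≡ suc c * n + c
    e′ = solve-∀

kBoxCount-binomial : ∀ k n → 1 ≤ n →
  forests (k + 2) (n ∸ 1) (k + 1) * ((k + 2) * n ∸ 1) ≡ ((k + 2) * n ∸ 1) C n
kBoxCount-binomial k (suc n) _ =
  subst₂ (λ m M → forests m n (k + 1) * M ≡ M C suc n)
         (sym (+-suc k 1)) (sym (cong (_∸ 1) (e k n))) (forests-binomial (k + 1) n)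
  where e : ∀ k n → (k + 2) * suc n ≡ suc (suc (k + 1) * n + (k + 1))
        e = solve-∀

kBoxCount-binomial′ : ∀ k n → 2 ≤ n →
  (n ∸ 1) * forests (k + 2) (n ∸ 1) (k + 1) ≡ (k + 1) * (((k + 2) * n ∸ 2) C (n ∸ 2))
kBoxCount-binomial′ k (suc zero) (s≤s ())
kBoxCount-binomial′ k (suc (suc s)) _ =
  subst₂ (λ m N → suc s * forests m (suc s) (k + 1) ≡ (k + 1) * (N C s))
         (sym (+-suc k 1)) (sym (cong (_∸ 2) (e k s))) (forests-closedForm (k + 1) s (k + 1))
  where e : ∀ k s → (k + 2) * suc (suc s) ≡ suc (suc (suc (k + 1) * s + (k + 1) + (k + 1)))
        e = solve-∀

record ForestRecursive (m : ℕ) (X : ℕ → ℕ → Set) : Set where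
  field
    zero-zero : X 0 0 ↔ Fin 1
    suc-zero       : ∀ s → X (suc s) 0 ↔ Fin 0
    zero-suc       : ∀ j → X 0 (suc j) ↔ X 0 j
    suc-suc        : ∀ s j → X (suc s) (suc j) ↔ (X (suc s) j ⊎ X s (m + j))

forests-count : ∀ {m X} → ForestRecursive m X → ∀ s j → X s j ↔ Fin (forests m s j)
forests-count r zero    zero    = ForestRecursive.zero-zero r
forests-count r (suc s) zero    = ForestRecursive.suc-zero r s
forests-count r zero    (suc j) = ↔-trans (ForestRecursive.zero-suc r j) (forests-count r zero j)
forests-count {m} r (suc s) (suc j) =
  ↔-trans (ForestRecursive.suc-suc r s j)
          (↔-trans (forests-count r (suc s) j ⊎-↔ forests-count r s (m + j)) (↔-sym +↔⊎))

Σ-≡-irrelevant : ∀ {A : Set} {P : A → Set} → (∀ a → Irrelevant (P a)) →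
                 ∀ {a a′} {p : P a} {p′ : P a′} → a ≡ a′ → (a , p) ≡ (a′ , p′)
Σ-≡-irrelevant irr refl = Σ-≡,≡→≡ (refl , irr _ _ _)

Forest : ℕ → ℕ → ℕ → Set
Forest m s j = Σ (Vec (Tree m) j) (λ ts → sizes ts ≡ s)

sizes-++ : ∀ {m a b} (us : Vec (Tree m) a) (ts : Vec (Tree m) b) →
           sizes (us Vec.++ ts) ≡ sizes us + sizes ts
sizes-++ []       ts = refl
sizes-++ (u ∷ us) ts = trans (cong (size u +_) (sizes-++ us ts)) (sym (+-assoc (size u) (sizes us) (sizes ts)))

forest-recursive : ∀ m → ForestRecursive m (Forest m)
forest-recursive m = record
  { zero-zero = mk↔ₛ′ (λ _ → Fin.zero) (λ _ → [] , refl) (λ { Fin.zero → refl ; (Fin.suc ()) }) (λ { ([] , refl) → refl })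
  ; suc-zero       = λ s → mk↔ₛ′ (λ { ([] , ()) }) (λ ()) (λ ()) (λ { ([] , ()) })
  ; zero-suc       = λ j → mk↔ₛ′ dropEmpty (λ (ts , p) → empty ∷ ts , p) (λ _ → refl) dropEmpty-inverse
  ; suc-suc        = λ s j → mk↔ₛ′ split join (split∘join s j) (join∘split s j)
  }
  where
  dropEmpty : ∀ {j} → Forest m 0 (suc j) → Forest m 0 j
  dropEmpty (empty ∷ ts , p) = ts , p
  dropEmpty (node _ ∷ _ , ())

  dropEmpty-inverse : ∀ {j} (f : Forest m 0 (suc j)) → (empty ∷ proj₁ (dropEmpty f) , proj₂ (dropEmpty f)) ≡ f
  dropEmpty-inverse (empty ∷ ts , p) = refl
  dropEmpty-inverse (node _ ∷ _ , ())

  split : ∀ {s j} → Forest m (suc s) (suc j) → Forest m (suc s) j ⊎ Forest m s (m + j)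
  split (empty    ∷ ts , p) = inj₁ (ts , p)
  split (node us ∷ ts , p) = inj₂ (us Vec.++ ts , trans (sizes-++ us ts) (suc-injective p))

  join : ∀ {s j} → Forest m (suc s) j ⊎ Forest m s (m + j) → Forest m (suc s) (suc j)
  join (inj₁ (ts , p)) = empty ∷ ts , p
  join (inj₂ (vs , p)) = node (take m vs) ∷ drop m vs ,
    cong suc (trans (sym (sizes-++ (take m vs) (drop m vs))) (trans (cong sizes (take++drop≡id m vs)) p))

  split∘join : ∀ s j (f : Forest m (suc s) j ⊎ Forest m s (m + j)) → split (join f) ≡ f
  split∘join s j (inj₁ _)        = refl
  split∘join s j (inj₂ (vs , _)) = cong inj₂ (Σ-≡-irrelevant (λ _ → ≡-irrelevant) (take++drop≡id m vs))

  join∘split : ∀ s j (f : Forest m (suc s) (suc j)) → join (split f) ≡ f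
  join∘split s j (empty ∷ ts , p)   = refl
  join∘split s j (node us ∷ ts , p) = Σ-≡-irrelevant (λ _ → ≡-irrelevant) (cong₂ (λ vs ws → node vs ∷ ws) take≡ drop≡)
    where
    take≡ : take m (us Vec.++ ts) ≡ us
    take≡ = proj₁ (++-injective _ us (take++drop≡id m (us Vec.++ ts)))
    drop≡ : drop m (us Vec.++ ts) ≡ ts
    drop≡ = proj₂ (++-injective _ us (take++drop≡id m (us Vec.++ ts)))

allB-map : ∀ {A B : Set} (f : B → Bool) (g : A → B) xs → allB f (map g xs) ≡ allB (f ∘ g) xs
allB-map f g []       = refl
allB-map f g (a ∷ xs) = cong (f (g a) ∧_) (allB-map f g xs)

allB-cong : ∀ {A : Set} {f g : A → Bool} → (∀ a → f a ≡ g a) → ∀ xs → allB f xs ≡ allB g xs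
allB-cong f≗g []       = refl
allB-cong f≗g (a ∷ xs) = cong₂ _∧_ (f≗g a) (allB-cong f≗g xs)

nonnegFrom : ℕ → List Step → Bool
nonnegFrom h       []      = true
nonnegFrom h       (U ∷ w) = nonnegFrom (suc h) w
nonnegFrom zero    (_ ∷ w) = false
nonnegFrom (suc h) (_ ∷ w) = nonnegFrom h w

prefixesWithin : ℕ → ℕ → List Step → Bool
prefixesWithin a b w = allB (λ p → countDL p + a ≤ᵇ countU p + b) (inits w)

prefixesWithin-∷ : ∀ c a b w →
  prefixesWithin a b (c ∷ w) ≡ (a ≤ᵇ b) ∧ prefixesWithin (b2n (isDL c) + a) (b2n (isU c) + b) w
prefixesWithin-∷ c a b w = cong ((a ≤ᵇ b) ∧_) (trans (allB-map _ (c ∷_) (inits w))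
  (allB-cong (λ p → cong₂ _≤ᵇ_ (shift (b2n (isDL c)) (countDL p) a) (shift (b2n (isU c)) (countU p) b)) (inits w)))
  where shift : ∀ x y z → x + y + z ≡ y + (x + z)
        shift = solve-∀

¬T⇒≡false : ∀ {b} → ¬ T b → b ≡ false
¬T⇒≡false {false} _  = refl
¬T⇒≡false {true}  ¬t = ⊥-elim (¬t _)

prefixesWithin-low : ∀ a b w → b < a → prefixesWithin a b w ≡ false
prefixesWithin-low a b w b<a rewrite ¬T⇒≡false (λ t → <⇒≱ b<a (≤ᵇ⇒≤ a b t)) = refl

private
  a≤ᵇa+h : ∀ a h → (a ≤ᵇ a + h) ≡ true
  a≤ᵇa+h a h = Equivalence.to T-≡ (≤⇒≤ᵇ (m≤m+n a h))

prefixesWithin≡nonnegFrom : ∀ a h w → prefixesWithin a (a + h) w ≡ nonnegFrom h w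
prefixesWithin≡nonnegFrom a h       []      = trans (∧-identityʳ _) (a≤ᵇa+h a h)
prefixesWithin≡nonnegFrom a h       (U ∷ w) = trans (prefixesWithin-∷ U a (a + h) w)
  (cong₂ _∧_ (a≤ᵇa+h a h) (trans (cong (λ b → prefixesWithin a b w) (sym (+-suc a h))) (prefixesWithin≡nonnegFrom a (suc h) w)))
prefixesWithin≡nonnegFrom a zero    (D ∷ w) = trans (prefixesWithin-∷ D a (a + 0) w)
  (cong₂ _∧_ (a≤ᵇa+h a 0) (prefixesWithin-low (suc a) (a + 0) w (s≤s (≤-reflexive (+-identityʳ a)))))
prefixesWithin≡nonnegFrom a zero    (L ∷ w) = trans (prefixesWithin-∷ L a (a + 0) w)
  (cong₂ _∧_ (a≤ᵇa+h a 0) (prefixesWithin-low (suc a) (a + 0) w (s≤s (≤-reflexive (+-identityʳ a)))))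
prefixesWithin≡nonnegFrom a (suc h) (D ∷ w) = trans (prefixesWithin-∷ D a (a + suc h) w)
  (cong₂ _∧_ (a≤ᵇa+h a (suc h)) (trans (cong (λ b → prefixesWithin (suc a) b w) (+-suc a h)) (prefixesWithin≡nonnegFrom (suc a) h w)))
prefixesWithin≡nonnegFrom a (suc h) (L ∷ w) = trans (prefixesWithin-∷ L a (a + suc h) w)
  (cong₂ _∧_ (a≤ᵇa+h a (suc h)) (trans (cong (λ b → prefixesWithin (suc a) b w) (+-suc a h)) (prefixesWithin≡nonnegFrom (suc a) h w)))

prefixOK≡nonnegFrom0 : ∀ w → prefixOK w ≡ nonnegFrom 0 w
prefixOK≡nonnegFrom0 w = trans
  (allB-cong (λ p → sym (cong₂ _≤ᵇ_ (+-identityʳ (countDL p)) (+-identityʳ (countU p)))) (inits w))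
  (prefixesWithin≡nonnegFrom 0 0 w)

data Letter : Set where
  u x : Letter

#x : List Letter → ℕ
#x []       = 0
#x (u ∷ ws) = #x ws
#x (x ∷ ws) = suc (#x ws)

#x-++ : ∀ vs ws → #x (vs ++ ws) ≡ #x vs + #x ws
#x-++ []       ws = refl
#x-++ (u ∷ vs) ws = #x-++ vs ws
#x-++ (x ∷ vs) ws = cong suc (#x-++ vs ws)

#x-reverse : ∀ ws → #x (reverse ws) ≡ #x ws
#x-reverse []       = refl
#x-reverse (a ∷ ws) = begin
  #x (reverse (a ∷ ws))     ≡⟨ cong #x (unfold-reverse a ws) ⟩
  #x (reverse ws ++ [ a ])  ≡⟨ #x-++ (reverse ws) [ a ] ⟩
  #x (reverse ws) + #x [ a ] ≡⟨ cong (_+ #x [ a ]) (#x-reverse ws) ⟩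
  #x ws + #x [ a ]          ≡⟨ +-comm (#x ws) (#x [ a ]) ⟩
  #x [ a ] + #x ws          ≡⟨ #x-++ [ a ] ws ⟨
  #x (a ∷ ws)               ∎

m+a≡ᵇm+b : ∀ m a b → (m + a ≡ᵇ m + b) ≡ (a ≡ᵇ b)
m+a≡ᵇm+b zero    a b = refl
m+a≡ᵇm+b (suc m) a b = m+a≡ᵇm+b m a b

module _ (m : ℕ) where

  -- j counts the trees still to be read; u is an empty tree and x a node with m subtrees.
  lukasiewicz : ℕ → ℕ → List Letter → Bool
  lukasiewicz j₀ j       []      = j ≡ᵇ j₀
  lukasiewicz j₀ zero    (_ ∷ _) = false
  lukasiewicz j₀ (suc j) (u ∷ r) = lukasiewicz j₀ j r
  lukasiewicz j₀ (suc j) (x ∷ r) = lukasiewicz j₀ (m + j) r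

  lukasiewicz-∷ʳu : ∀ j₀ j r → lukasiewicz j₀ j (r ++ [ u ]) ≡ lukasiewicz (suc j₀) j r
  lukasiewicz-∷ʳu j₀ zero    []      = refl
  lukasiewicz-∷ʳu j₀ (suc j) []      = refl
  lukasiewicz-∷ʳu j₀ zero    (_ ∷ r) = refl
  lukasiewicz-∷ʳu j₀ (suc j) (u ∷ r) = lukasiewicz-∷ʳu j₀ j r
  lukasiewicz-∷ʳu j₀ (suc j) (x ∷ r) = lukasiewicz-∷ʳu j₀ (m + j) r

  lukasiewicz-∷ʳx : ∀ t j r → lukasiewicz (m + t) j (r ++ [ x ]) ≡ lukasiewicz (suc t) j r
  lukasiewicz-∷ʳx t zero    []      = refl
  lukasiewicz-∷ʳx t (suc j) []      = m+a≡ᵇm+b m j t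
  lukasiewicz-∷ʳx t zero    (_ ∷ r) = refl
  lukasiewicz-∷ʳx t (suc j) (u ∷ r) = lukasiewicz-∷ʳx t j r
  lukasiewicz-∷ʳx t (suc j) (x ∷ r) = lukasiewicz-∷ʳx t (m + j) r

  lukasiewicz-∷ʳx-low : ∀ j₀ j r → j₀ < m → lukasiewicz j₀ j (r ++ [ x ]) ≡ false
  lukasiewicz-∷ʳx-low j₀ zero    []      _  = refl
  lukasiewicz-∷ʳx-low j₀ (suc j) []      lt =
    ¬T⇒≡false (λ t → <⇒≱ lt (subst (m ≤_) (≡ᵇ⇒≡ (m + j) j₀ t) (m≤m+n m j)))
  lukasiewicz-∷ʳx-low j₀ zero    (_ ∷ r) _  = refl
  lukasiewicz-∷ʳx-low j₀ (suc j) (u ∷ r) lt = lukasiewicz-∷ʳx-low j₀ j r lt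
  lukasiewicz-∷ʳx-low j₀ (suc j) (x ∷ r) lt = lukasiewicz-∷ʳx-low j₀ (m + j) r lt

  lukasiewicz-length : ∀ j₀ j r → T (lukasiewicz j₀ j r) → j₀ + length r ≡ j + m * #x r
  lukasiewicz-length j₀ j       []      t = begin
    j₀ + 0      ≡⟨ +-identityʳ j₀ ⟩
    j₀          ≡⟨ ≡ᵇ⇒≡ j j₀ t ⟨
    j           ≡⟨ +-identityʳ j ⟨
    j + 0       ≡⟨ cong (j +_) (*-zeroʳ m) ⟨
    j + m * 0   ∎
  lukasiewicz-length j₀ (suc j) (u ∷ r) t = trans (+-suc j₀ (length r)) (cong suc (lukasiewicz-length j₀ j r t))
  lukasiewicz-length j₀ (suc j) (x ∷ r) t = begin
    j₀ + suc (length r)      ≡⟨ +-suc j₀ (length r) ⟩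
    suc (j₀ + length r)      ≡⟨ cong suc (lukasiewicz-length j₀ (m + j) r t) ⟩
    suc (m + j + m * #x r)   ≡⟨ e m j (#x r) ⟩
    suc j + m * suc (#x r)   ∎
    where e : ∀ m j y → suc (m + j + m * y) ≡ suc j + m * suc y
          e = solve-∀

  -- Codes of j-tuples with s nodes, with their last letter (always u) dropped; the empty
  -- tuple has no last letter, hence the separate case j = 0.
  Code : ℕ → ℕ → Set
  Code s zero    = s ≡ 0
  Code s (suc j) = Σ (List Letter) (λ r → T (lukasiewicz 1 (suc j) r) × #x r ≡ s)

code-recursive : ∀ c → ForestRecursive (suc c) (Code (suc c))
code-recursive c = record
  { zero-zero = mk↔ₛ′ (λ _ → Fin.zero) (λ _ → refl) (λ { Fin.zero → refl ; (Fin.suc ()) }) (λ { refl → refl })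
  ; suc-zero       = λ s → mk↔ₛ′ (λ ()) (λ ()) (λ ()) (λ ())
  ; zero-suc       = first-u
  ; suc-suc        = first-letter
  }
  where
  m = suc c
  irr : ∀ {s j} r → Irrelevant (T (lukasiewicz m 1 (suc j) r) × #x r ≡ s)
  irr _ (a , b) (a′ , b′) = cong₂ _,_ (T-irrelevant a a′) (≡-irrelevant b b′)

  first-u : ∀ j → Code m 0 (suc j) ↔ Code m 0 j
  first-u zero    = mk↔ₛ′ (λ _ → refl) (λ _ → [] , _ , refl) (λ { refl → refl }) only-[]
    where
    only-[] : ∀ (w : Code m 0 1) → ([] , _ , refl) ≡ w
    only-[] ([] , _ , refl)          = Σ-≡-irrelevant irr refl
    only-[] (u ∷ []      , () , _)
    only-[] (u ∷ (_ ∷ _) , () , _)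
    only-[] (x ∷ _       , _  , ())
  first-u (suc j) = mk↔ₛ′ drop-u (λ (r , t , e) → u ∷ r , t , e) (λ _ → refl) u∷-drop-u
    where
    drop-u : Code m 0 (suc (suc j)) → Code m 0 (suc j)
    drop-u (u ∷ r , t , e) = r , t , e
    drop-u (x ∷ r , _ , ())
    u∷-drop-u : ∀ w → (let (r , t , e) = drop-u w in (u ∷ r , t , e)) ≡ w
    u∷-drop-u (u ∷ r , t , e) = refl
    u∷-drop-u (x ∷ r , _ , ())

  first-letter : ∀ s j → Code m (suc s) (suc j) ↔ (Code m (suc s) j ⊎ Code m s (m + j))
  first-letter s j = mk↔ₛ′ (split j) (join j) (split∘join j) (join∘split j)
    where
    split : ∀ j → Code m (suc s) (suc j) → Code m (suc s) j ⊎ Code m s (m + j)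
    split j       (x ∷ r , t , e)      = inj₂ (r , t , suc-injective e)
    split (suc j) (u ∷ r , t , e)      = inj₁ (r , t , e)
    split zero    (u ∷ []    , () , _)
    split zero    (u ∷ _ ∷ _ , () , _)
    split j       ([] , _ , ())

    join : ∀ j → Code m (suc s) j ⊎ Code m s (m + j) → Code m (suc s) (suc j)
    join zero    (inj₁ ())
    join (suc j) (inj₁ (r , t , e)) = u ∷ r , t , e
    join j       (inj₂ (r , t , e)) = x ∷ r , t , cong suc e

    split∘join : ∀ j w → split j (join j w) ≡ w
    split∘join zero    (inj₁ ())
    split∘join (suc j) (inj₁ _) = refl
    split∘join zero    (inj₂ _) = cong inj₂ (Σ-≡-irrelevant irr refl)
    split∘join (suc j) (inj₂ _) = cong inj₂ (Σ-≡-irrelevant irr refl)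

    join∘split : ∀ j w → join j (split j w) ≡ w
    join∘split zero    (x ∷ r , t , e)      = Σ-≡-irrelevant irr refl
    join∘split (suc j) (x ∷ r , t , e)      = Σ-≡-irrelevant irr refl
    join∘split (suc j) (u ∷ r , t , e)      = refl
    join∘split zero    (u ∷ []    , () , _)
    join∘split zero    (u ∷ _ ∷ _ , () , _)
    join∘split j       ([] , _ , ())

occurrences-here : ∀ p c w → T (isPrefixOf p (c ∷ w)) → occurrences p (c ∷ w) ≡ suc (occurrences p w)
occurrences-here p c w t with isPrefixOf p (c ∷ w)
... | true = refl

occurrences-skip : ∀ p c w → isPrefixOf p (c ∷ w) ≡ false → occurrences p (c ∷ w) ≡ occurrences p w
occurrences-skip p c w f with isPrefixOf p (c ∷ w)
... | false = refl

=ˢ⇒≡ : ∀ a b → T (a =ˢ b) → a ≡ b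
=ˢ⇒≡ U U _ = refl
=ˢ⇒≡ D D _ = refl
=ˢ⇒≡ L L _ = refl

isPrefixOf⇒++ : ∀ p w → T (isPrefixOf p w) → ∃ λ r → w ≡ p ++ r
isPrefixOf⇒++ []      w       _ = w , refl
isPrefixOf⇒++ (a ∷ p) (b ∷ w) t with Equivalence.to T-∧ t
... | a=b , rest with isPrefixOf⇒++ p w rest
...   | r , refl = r , cong (_∷ p ++ r) (sym (=ˢ⇒≡ a b a=b))

noULLU-tail : ∀ c w → noULLU (c ∷ w) ≡ true → noULLU w ≡ true
noULLU-tail U []      t = t
noULLU-tail U (U ∷ w) t = t
noULLU-tail U (D ∷ w) t = t
noULLU-tail D w       t = t
noULLU-tail L []      t = t
noULLU-tail L (D ∷ w) t = t
noULLU-tail L (L ∷ w) t = t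

record IsKBoxPath (k n : ℕ) (w : List Step) : Set where
  field
    avoidsULLU : noULLU w ≡ true
    balanced   : countU w ≡ countDL w
    prefixes   : prefixOK w ≡ true
    semilength : countU w ≡ (k + 2) * n ∸ 1
    boxCount   : occurrences (box k) w ≡ n

T-isKBoxPath : ∀ {k n w} → T (isKBoxPath k n w) ⇔ IsKBoxPath k n w
T-isKBoxPath {k} {n} {w} = mk⇔ split join
  where
  split : T (isKBoxPath k n w) → IsKBoxPath k n w
  split t with Equivalence.to (T-∧ {isSkewDyck w}) t
  ... | skewDyck , sized with Equivalence.to T-∧ skewDyck | Equivalence.to T-∧ sized
  ... | nU , rest | sl , bc with Equivalence.to T-∧ rest
  ... | bal , pOK = record
    { avoidsULLU = Equivalence.to T-≡ nU
    ; balanced   = ≡ᵇ⇒≡ _ _ bal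
    ; prefixes   = Equivalence.to T-≡ pOK
    ; semilength = ≡ᵇ⇒≡ _ _ sl
    ; boxCount   = ≡ᵇ⇒≡ _ _ bc
    }
  join : IsKBoxPath k n w → T (isKBoxPath k n w)
  join p = (≡⇒T avoidsULLU ∧ᵀ (≡⇒≡ᵇ _ _ balanced ∧ᵀ ≡⇒T prefixes)) ∧ᵀ (≡⇒≡ᵇ _ _ semilength ∧ᵀ ≡⇒≡ᵇ _ _ boxCount)
    where
    open IsKBoxPath p
    ≡⇒T : ∀ {b} → b ≡ true → T b
    ≡⇒T = Equivalence.from T-≡
    _∧ᵀ_ : ∀ {a b} → T a → T b → T (a ∧ b)
    p ∧ᵀ q = Equivalence.from T-∧ (p , q)

module BoxPaths (k′ : ℕ) where

  k m : ℕ
  k = suc k′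
  m = suc (suc k)

  -- Bracketed so that box (suc j) ++ t reduces to U ∷ D ∷ descent j t.
  descent : ℕ → List Step → List Step
  descent j t = (replicate j D ++ [ L ]) ++ t

  path : List Letter → List Step
  path []       = box k
  path (u ∷ ws) = U ∷ path ws
  path (x ∷ ws) = box k ++ D ∷ path ws

  boxes : List Step → ℕ
  boxes = occurrences (box k)

  path-head : ∀ ws → ∃ λ t → path ws ≡ U ∷ t
  path-head []      = _ , refl
  path-head (u ∷ _) = _ , refl
  path-head (x ∷ _) = _ , refl

  noULLU-descent : ∀ j t → noULLU (descent j t) ≡ noULLU (L ∷ t)
  noULLU-descent zero    t = refl
  noULLU-descent (suc j) t = noULLU-descent j t

  noULLU-path : ∀ ws → noULLU (path ws) ≡ true
  noULLU-path []       = trans (cong noULLU (sym (++-identityʳ (box k)))) (noULLU-descent k′ [])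
  noULLU-path (u ∷ ws) with path ws | path-head ws | noULLU-path ws
  ... | _ | _ , refl | ih = ih
  noULLU-path (x ∷ ws) = trans (noULLU-descent k′ (D ∷ path ws)) (noULLU-path ws)

  boxes-descent : ∀ j t → boxes (descent j t) ≡ boxes t
  boxes-descent zero    t = refl
  boxes-descent (suc j) t = boxes-descent j t

  isPrefixOf-descent : ∀ j t → T (isPrefixOf (replicate j D ++ [ L ]) (descent j t))
  isPrefixOf-descent zero    t = _
  isPrefixOf-descent (suc j) t = isPrefixOf-descent j t

  boxes-box++ : ∀ t → boxes (box k ++ t) ≡ suc (boxes t)
  boxes-box++ t = trans (occurrences-here (box k) U (D ∷ descent k′ t) (isPrefixOf-descent k′ t))
                        (cong suc (boxes-descent k′ t))

  boxes-path : ∀ ws → boxes (path ws) ≡ suc (#x ws)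
  boxes-path []       = trans (cong boxes (sym (++-identityʳ (box k)))) (boxes-box++ [])
  boxes-path (u ∷ ws) with path ws | path-head ws | boxes-path ws
  ... | _ | _ , refl | ih = ih
  boxes-path (x ∷ ws) = trans (boxes-box++ (D ∷ path ws)) (cong suc (boxes-path ws))

  countU-descent : ∀ j t → countU (descent j t) ≡ countU t
  countU-descent zero    t = refl
  countU-descent (suc j) t = countU-descent j t

  countDL-descent : ∀ j t → countDL (descent j t) ≡ suc j + countDL t
  countDL-descent zero    t = refl
  countDL-descent (suc j) t = cong suc (countDL-descent j t)

  countU-path : ∀ ws → countU (path ws) ≡ suc (length ws)
  countU-path []       = trans (cong countU (sym (++-identityʳ (box k)))) (cong suc (countU-descent k′ []))
  countU-path (u ∷ ws) = cong suc (countU-path ws)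
  countU-path (x ∷ ws) = cong suc (trans (countU-descent k′ (D ∷ path ws)) (countU-path ws))

  countDL-path : ∀ ws → countDL (path ws) ≡ suc k + m * #x ws
  countDL-path []       = begin
    countDL (path [])      ≡⟨ cong countDL (++-identityʳ (box k)) ⟨
    countDL (box k ++ [])  ≡⟨ cong suc (countDL-descent k′ []) ⟩
    suc k + 0              ≡⟨ cong (suc k +_) (*-zeroʳ m) ⟨
    suc k + m * 0          ∎
  countDL-path (u ∷ ws) = countDL-path ws
  countDL-path (x ∷ ws) = begin
    countDL (box k ++ D ∷ path ws)    ≡⟨ cong suc (countDL-descent k′ (D ∷ path ws)) ⟩
    suc k + suc (countDL (path ws))   ≡⟨ cong (λ c → suc k + suc c) (countDL-path ws) ⟩
    suc k + suc (suc k + m * #x ws)   ≡⟨ e k (#x ws) ⟩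
    suc k + m * suc (#x ws)           ∎
    where e : ∀ k y → suc k + suc (suc k + suc (suc k) * y) ≡ suc k + suc (suc k) * suc y
          e = solve-∀

  path-balance : ∀ ws → countDL (path ws) + 1 ≡ m * boxes (path ws)
  path-balance ws = begin
    countDL (path ws) + 1       ≡⟨ cong (_+ 1) (countDL-path ws) ⟩
    suc k + m * #x ws + 1       ≡⟨ e k (#x ws) ⟩
    m * suc (#x ws)             ≡⟨ cong (m *_) (boxes-path ws) ⟨
    m * boxes (path ws)         ∎
    where e : ∀ k y → suc k + suc (suc k) * y + 1 ≡ suc (suc k) * suc y
          e = solve-∀

  nonnegFrom-descent : ∀ j t r → nonnegFrom (suc j + t) (descent j r) ≡ nonnegFrom t r
  nonnegFrom-descent zero    t r = refl
  nonnegFrom-descent (suc j) t r = nonnegFrom-descent j t r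

  nonnegFrom-descentD-low : ∀ j h r → h ≤ suc j → nonnegFrom h (descent j (D ∷ r)) ≡ false
  nonnegFrom-descentD-low zero    zero       r _           = refl
  nonnegFrom-descentD-low zero    (suc zero) r _           = refl
  nonnegFrom-descentD-low zero    (suc (suc h)) r (s≤s ())
  nonnegFrom-descentD-low (suc j) zero       r _           = refl
  nonnegFrom-descentD-low (suc j) (suc h)    r (s≤s h≤1+j) = nonnegFrom-descentD-low j h r h≤1+j

  nonnegFrom-box : ∀ t → nonnegFrom (k + t) (box k) ≡ true
  nonnegFrom-box t = trans (cong (nonnegFrom (k + t)) (sym (++-identityʳ (box k)))) (nonnegFrom-descent k′ t [])

  nonnegFrom-boxD : ∀ t r → nonnegFrom (suc k + t) (box k ++ D ∷ r) ≡ nonnegFrom t r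
  nonnegFrom-boxD t r = trans (cong (λ h → nonnegFrom h (descent k′ (D ∷ r))) (sym (+-suc k t)))
                              (nonnegFrom-descent k′ (suc t) (D ∷ r))

  nonnegFrom-boxD-low : ∀ h r → h ≤ k → nonnegFrom h (box k ++ D ∷ r) ≡ false
  nonnegFrom-boxD-low h r = nonnegFrom-descentD-low k′ h r

  -- The balance hypothesis says that the walk from height h ends at height e ∸ k.
  nonnegFrom-path : ∀ h e ws → k ≤ e → h + length ws ≡ e + m * #x ws →
                    nonnegFrom h (path ws) ≡ lukasiewicz m (suc h) (suc e) (reverse ws)
  nonnegFrom-path h e [] k≤e balanced
    with +-cancelʳ-≡ 0 h e (trans balanced (cong (e +_) (*-zeroʳ m))) | m≤n⇒∃[o]m+o≡n k≤e
  ... | refl | t , refl = trans (nonnegFrom-box t) (sym (Equivalence.to T-≡ (≡⇒≡ᵇ (k + t) (k + t) refl)))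
  nonnegFrom-path h e (u ∷ ws) k≤e balanced = begin
    nonnegFrom (suc h) (path ws)                               ≡⟨ nonnegFrom-path (suc h) e ws k≤e (trans (sym (+-suc h (length ws))) balanced) ⟩
    lukasiewicz m (suc (suc h)) (suc e) (reverse ws)           ≡⟨ lukasiewicz-∷ʳu m (suc h) (suc e) (reverse ws) ⟨
    lukasiewicz m (suc h) (suc e) (reverse ws ++ [ u ])        ≡⟨ cong (lukasiewicz m (suc h) (suc e)) (unfold-reverse u ws) ⟨
    lukasiewicz m (suc h) (suc e) (reverse (u ∷ ws))           ∎
  nonnegFrom-path h e (x ∷ ws) k≤e balanced with suc k ≤? h
  ... | no h≯k = begin
    nonnegFrom h (box k ++ D ∷ path ws)                        ≡⟨ nonnegFrom-boxD-low h (path ws) (≤-pred (≰⇒> h≯k)) ⟩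
    false                                                      ≡⟨ lukasiewicz-∷ʳx-low m (suc h) (suc e) (reverse ws) (s≤s (≰⇒> h≯k)) ⟨
    lukasiewicz m (suc h) (suc e) (reverse ws ++ [ x ])        ≡⟨ cong (lukasiewicz m (suc h) (suc e)) (unfold-reverse x ws) ⟨
    lukasiewicz m (suc h) (suc e) (reverse (x ∷ ws))           ∎
  ... | yes h>k with m≤n⇒∃[o]m+o≡n h>k
  ...   | t , refl = begin
    nonnegFrom (suc k + t) (box k ++ D ∷ path ws)              ≡⟨ nonnegFrom-boxD t (path ws) ⟩
    nonnegFrom t (path ws)                                     ≡⟨ nonnegFrom-path t e ws k≤e balanced′ ⟩
    lukasiewicz m (suc t) (suc e) (reverse ws)                 ≡⟨ lukasiewicz-∷ʳx m t (suc e) (reverse ws) ⟨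
    lukasiewicz m (m + t) (suc e) (reverse ws ++ [ x ])        ≡⟨ cong (lukasiewicz m (m + t) (suc e)) (unfold-reverse x ws) ⟨
    lukasiewicz m (m + t) (suc e) (reverse (x ∷ ws))           ∎
    where
    e₁ : ∀ k t l → suc k + t + suc l ≡ suc (suc k) + (t + l)
    e₁ = solve-∀
    e₂ : ∀ k e y → e + suc (suc k) * suc y ≡ suc (suc k) + (e + suc (suc k) * y)
    e₂ = solve-∀
    balanced′ : t + length ws ≡ e + m * #x ws
    balanced′ = +-cancelˡ-≡ m _ _ (trans (sym (e₁ k t (length ws))) (trans balanced (e₂ k e (#x ws))))

  boxes-lower : ∀ t r → countDL t ≡ suc (countDL r) → boxes t ≡ boxes r →
                countDL (box k ++ t) + 1 ≤ m * boxes (box k ++ t) → countDL r + 1 ≤ m * boxes r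
  boxes-lower t r countDL-t boxes-t excess = +-cancelˡ-≤ m _ _ (subst₂ _≤_ countDL≡ boxes≡ excess)
    where
    e : ∀ k c → suc k + suc c + 1 ≡ suc (suc k) + (c + 1)
    e = solve-∀
    countDL≡ : countDL (box k ++ t) + 1 ≡ m + (countDL r + 1)
    countDL≡ = trans (cong (λ c → suc c + 1) (trans (countDL-descent k′ t) (cong (k +_) countDL-t))) (e k (countDL r))
    boxes≡ : m * boxes (box k ++ t) ≡ m + m * boxes r
    boxes≡ = trans (cong (m *_) (trans (boxes-box++ t) (cong suc boxes-t))) (*-suc m (boxes r))

  beyond-path : ∀ ws → ¬ (suc (countDL (path ws)) + 1 ≤ m * boxes (path ws))
  beyond-path ws excess = 1+n≰n (≤-trans excess (≤-reflexive (sym (path-balance ws))))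

  length-after-box : ∀ r w → U ∷ w ≡ box k ++ r → length r ≤ length w
  length-after-box r w eq =
    subst (length r ≤_) (suc-injective (trans (sym (length-++ (box k))) (cong length (sym eq)))) (m≤n+m (length r) _)

  -- The inequality, an equality on paths (path-balance), rules out a leading D or L, after
  -- which the rest would already be a path.
  private
    complete : ∀ f w → length w ≤ f → noULLU w ≡ true → countDL w + 1 ≤ m * boxes w → ∃ λ ws → w ≡ path ws
    completeBox : ∀ f r → length r ≤ f → noULLU (box k ++ r) ≡ true →
                  countDL (box k ++ r) + 1 ≤ m * boxes (box k ++ r) → ∃ λ ws → box k ++ r ≡ path ws

    complete f       []      _  _  excess = ⊥-elim (1+n≰n (≤-trans excess (≤-reflexive (*-zeroʳ m))))
    complete zero    (_ ∷ _) () _  _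
    complete (suc f) (D ∷ w) le nU excess with complete f w (≤-pred le) nU (≤-trans (n≤1+n _) excess)
    ... | ws , refl = ⊥-elim (beyond-path ws excess)
    complete (suc f) (L ∷ w) le nU excess with complete f w (≤-pred le) (noULLU-tail L w nU) (≤-trans (n≤1+n _) excess)
    ... | ws , refl = ⊥-elim (beyond-path ws excess)
    complete (suc f) (U ∷ w) le nU excess with T? (isPrefixOf (box k) (U ∷ w))
    ... | no ¬boxFirst with complete f w (≤-pred le) (noULLU-tail U w nU)
                         (subst (λ b → countDL w + 1 ≤ m * b) (occurrences-skip (box k) U w (¬T⇒≡false ¬boxFirst)) excess)
    ...   | ws , refl = u ∷ ws , refl
    complete (suc f) (U ∷ w) le nU excess | yes boxFirst with isPrefixOf⇒++ (box k) (U ∷ w) boxFirst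
    ...   | r , eq with completeBox f r (≤-trans (length-after-box r w eq) (≤-pred le)) (subst (λ v → noULLU v ≡ true) eq nU)
                                      (subst (λ v → countDL v + 1 ≤ m * boxes v) eq excess)
    ...     | ws , eq′ = ws , trans eq eq′

    completeBox f       []      _  _  _      = [] , ++-identityʳ (box k)
    completeBox f       (U ∷ r) _  nU _      with trans (sym (noULLU-descent k′ (U ∷ r))) nU
    ... | ()
    completeBox zero    (_ ∷ _) () _  _
    completeBox (suc f) (D ∷ r) le nU excess with complete f r (≤-pred le) (trans (sym (noULLU-descent k′ (D ∷ r))) nU)
                                                     (boxes-lower (D ∷ r) r refl refl excess)
    ... | ws , refl = x ∷ ws , refl
    completeBox (suc f) (L ∷ r) le nU excess with complete f r (≤-pred le) (noULLU-tail L r (trans (sym (noULLU-descent k′ (L ∷ r))) nU))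
                                                     (boxes-lower (L ∷ r) r refl refl excess)
    ... | ws , refl with path ws | path-head ws | trans (sym (noULLU-descent k′ (L ∷ path ws))) nU
    ...   | _ | _ , refl | ()

  path-complete : ∀ w → noULLU w ≡ true → countDL w + 1 ≤ m * boxes w → ∃ λ ws → w ≡ path ws
  path-complete w = complete (length w) w ≤-refl

  path-injective : ∀ {ws ws′} → path ws ≡ path ws′ → ws ≡ ws′
  path-injective {[]}     {[]}      _  = refl
  path-injective {[]}     {u ∷ ws′} eq with path ws′ | path-head ws′
  ... | _ | _ , refl with eq
  ...   | ()
  path-injective {[]}     {x ∷ ws′} eq with ++-cancelˡ (box k) [] (D ∷ path ws′) (trans (++-identityʳ (box k)) eq)
  ... | ()
  path-injective {u ∷ ws} {[]}      eq with path ws | path-head ws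
  ... | _ | _ , refl with eq
  ...   | ()
  path-injective {u ∷ ws} {u ∷ ws′} eq = cong (u ∷_) (path-injective (∷-injectiveʳ eq))
  path-injective {u ∷ ws} {x ∷ ws′} eq with path ws | path-head ws
  ... | _ | _ , refl with eq
  ...   | ()
  path-injective {x ∷ ws} {[]}      eq with ++-cancelˡ (box k) (D ∷ path ws) [] (trans eq (sym (++-identityʳ (box k))))
  ... | ()
  path-injective {x ∷ ws} {u ∷ ws′} eq with path ws′ | path-head ws′
  ... | _ | _ , refl with eq
  ...   | ()
  path-injective {x ∷ ws} {x ∷ ws′} eq = cong (x ∷_) (path-injective (∷-injectiveʳ (++-cancelˡ (box k) _ _ eq)))

  countU-kBox : ∀ n → (k + 2) * suc n ∸ 1 ≡ suc (k + m * n)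
  countU-kBox n = cong (_∸ 1) (e k n)
    where e : ∀ k n → (k + 2) * suc n ≡ suc (suc (k + suc (suc k) * n))
          e = solve-∀

  path-isKBoxPath : ∀ n ws → T (lukasiewicz m 1 (suc k) (reverse ws)) → #x ws ≡ n →
                    IsKBoxPath k (suc n) (path ws)
  path-isKBoxPath n ws code #x≡n = record
    { avoidsULLU = noULLU-path ws
    ; balanced   = trans (countU-path ws) (trans (cong suc len) (sym (countDL-path ws)))
    ; prefixes   = trans (prefixOK≡nonnegFrom0 (path ws)) (trans (nonnegFrom-path 0 k ws ≤-refl len) (Equivalence.to T-≡ code))
    ; semilength = trans (countU-path ws) (trans (cong suc (trans len (cong (λ y → k + m * y) #x≡n))) (sym (countU-kBox n)))
    ; boxCount   = trans (boxes-path ws) (cong suc #x≡n)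
    }
    where
    len : length ws ≡ k + m * #x ws
    len = suc-injective (begin
      1 + length ws               ≡⟨ cong (1 +_) (length-reverse ws) ⟨
      1 + length (reverse ws)     ≡⟨ lukasiewicz-length m 1 (suc k) (reverse ws) code ⟩
      suc k + m * #x (reverse ws) ≡⟨ cong (λ y → suc k + m * y) (#x-reverse ws) ⟩
      suc k + m * #x ws           ∎)

  isKBoxPath⇒path : ∀ n w → IsKBoxPath k (suc n) w →
                    ∃ λ ws → w ≡ path ws × T (lukasiewicz m 1 (suc k) (reverse ws)) × #x ws ≡ n
  isKBoxPath⇒path n w p = ws , w≡path , code , #x≡n
    where
    open IsKBoxPath p
    excess : countDL w + 1 ≤ m * boxes w
    excess = ≤-reflexive (begin
      countDL w + 1               ≡⟨ cong (_+ 1) balanced ⟨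
      countU w + 1                ≡⟨ cong (_+ 1) (trans semilength (countU-kBox n)) ⟩
      suc (k + m * n) + 1         ≡⟨ e k n ⟩
      m * suc n                   ≡⟨ cong (m *_) boxCount ⟨
      m * boxes w                 ∎)
      where e : ∀ k n → suc (k + suc (suc k) * n) + 1 ≡ suc (suc k) * suc n
            e = solve-∀

    ws = proj₁ (path-complete w avoidsULLU excess)
    w≡path = proj₂ (path-complete w avoidsULLU excess)

    #x≡n : #x ws ≡ n
    #x≡n = suc-injective (trans (sym (boxes-path ws)) (trans (cong boxes (sym w≡path)) boxCount))

    len : length ws ≡ k + m * #x ws
    len = suc-injective (begin
      suc (length ws)      ≡⟨ countU-path ws ⟨
      countU (path ws)     ≡⟨ cong countU w≡path ⟨
      countU w             ≡⟨ balanced ⟩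
      countDL w            ≡⟨ cong countDL w≡path ⟩
      countDL (path ws)    ≡⟨ countDL-path ws ⟩
      suc k + m * #x ws    ∎)

    code : T (lukasiewicz m 1 (suc k) (reverse ws))
    code = Equivalence.from T-≡ (begin
      lukasiewicz m 1 (suc k) (reverse ws) ≡⟨ nonnegFrom-path 0 k ws ≤-refl len ⟨
      nonnegFrom 0 (path ws)               ≡⟨ prefixOK≡nonnegFrom0 (path ws) ⟨
      prefixOK (path ws)                   ≡⟨ cong prefixOK w≡path ⟨
      prefixOK w                           ≡⟨ prefixes ⟩
      true                                 ∎)

  kBoxPath↔code : ∀ n → KBoxPath k (suc n) ↔ Code m n (suc k)
  kBoxPath↔code n = mk↔ₛ′ encode decode encode∘decode decode∘encode
    where
    encode : KBoxPath k (suc n) → Code m n (suc k)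
    encode (w , t) = let (ws , _ , code , #x≡n) = isKBoxPath⇒path n w (Equivalence.to T-isKBoxPath t) in
                     reverse ws , code , trans (#x-reverse ws) #x≡n
    decode : Code m n (suc k) → KBoxPath k (suc n)
    decode (r , code , #x≡n) = path (reverse r) , Equivalence.from T-isKBoxPath (path-isKBoxPath n (reverse r)
      (subst (T ∘ lukasiewicz m 1 (suc k)) (sym (reverse-involutive r)) code) (trans (#x-reverse r) #x≡n))
    encode∘decode : ∀ c → encode (decode c) ≡ c
    encode∘decode (r , code , #x≡n) = Σ-≡-irrelevant irr (begin
      reverse ws            ≡⟨ cong reverse (path-injective {ws} {reverse r} (sym eq)) ⟩
      reverse (reverse r)   ≡⟨ reverse-involutive r ⟩
      r                     ∎)
      where
      irr : ∀ r → Irrelevant (T (lukasiewicz m 1 (suc k) r) × #x r ≡ n)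
      irr _ (a , b) (a′ , b′) = cong₂ _,_ (T-irrelevant a a′) (≡-irrelevant b b′)
      decoded = isKBoxPath⇒path n (path (reverse r)) (Equivalence.to T-isKBoxPath (proj₂ (decode (r , code , #x≡n))))
      ws = proj₁ decoded
      eq = proj₁ (proj₂ decoded)
    decode∘encode : ∀ p → decode (encode p) ≡ p
    decode∘encode (w , t) = Σ-≡-irrelevant (λ _ → T-irrelevant) (begin
      path (reverse (reverse ws)) ≡⟨ cong path (reverse-involutive ws) ⟩
      path ws                     ≡⟨ proj₁ (proj₂ decoded) ⟨
      w                           ∎)
      where
      decoded = isKBoxPath⇒path n w (Equivalence.to T-isKBoxPath t)
      ws = proj₁ decoded

kBoxPath↔forests : ∀ k n → 1 ≤ k → KBoxPath k (suc n) ↔ Fin (forests (k + 2) n (k + 1))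
kBoxPath↔forests (suc k′) n _ =
  subst (λ f → KBoxPath (suc k′) (suc n) ↔ Fin f)
        (sym (cong₂ (λ m j → forests m n j) (+-comm (suc k′) 2) (+-comm (suc k′) 1)))
        (↔-trans (BoxPaths.kBoxPath↔code k′ n) (forests-count (code-recursive (suc (suc k′))) n (suc (suc k′))))

theorem3p5 : (k n : ℕ) → 1 ≤ k → 1 ≤ n →
    Σ ℕ (λ f →
      (KBoxPath k n ↔ Fin f) × (TreeTuple k n ↔ Fin f)
      × (f * ((k + 2) * n ∸ 1) ≡ ((k + 2) * n ∸ 1) C n)
      × (2 ≤ n → (n ∸ 1) * f ≡ (k + 1) * (((k + 2) * n ∸ 2) C (n ∸ 2))))
theorem3p5 k (suc n) 1≤k 1≤n =
  forests (k + 2) n (k + 1) ,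
  kBoxPath↔forests k n 1≤k ,
  forests-count (forest-recursive (k + 2)) n (k + 1) ,
  kBoxCount-binomial k (suc n) 1≤n ,
  kBoxCount-binomial′ k (suc n)
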